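{- Let $G=(V,E)$ be a control-flow graph with entry $s$ and terminal $t$ as in the context, and let $u\in V$ be an ambiguous vertex. Let $X=N^{in}(u)\cap A(u)\cap B(u)$ and $Y=N^{out}(u)\cap A(u)\cap B(u)$. Then every valid vertex-coverage edge-instrumentation scheme $(F,\Psi)$ for $G$ satisfies: either $F$ contains every edge $(x,u)$ with $x\in X$, or $F$ contains every edge $(u,y)$ with $y\in Y$.
   Context: $G=(V,E)$ is a finite directed graph with distinct nodes $s,t$ such that $s$ has in-degree $0$, $t$ has out-degree $0$, every node is reachable from $s$ and every node can reach $t$ by directed paths. $N^{in}(u),N^{out}(u)$ denote in- and out-neighbour sets. An execution trace is a finite collection of (not necessarily simple) directed $s$-$t$ walks. Its vertex coverage profile $C:V\to\{\top,\bot\}$ has $C(u)=\top$ iff $u$ lies on some walk of the trace, and its edge coverage profile $C^E:E\to\{\top,\bot\}$ has $C^E(e)=\top$ iff $e$ is traversed by some walk. A vertex-coverage edge-instrumentation scheme is a pair $(F,\Psi)$ with $F\subseteq E$ and $\Psi$ an efficiently computable map from restrictions to $F$ of edge coverage profiles to vertex coverage profiles; it is valid if $\Psi(C^E|_F)=C$ for every execution trace with vertex coverage profile $C$ and edge coverage profile $C^E$; its size is $|F|$. $A(u)$ is the set of nodes reachable from $s$ by a directed path avoiding $u$; $B(u)$ the set of nodes that can reach $t$ by a directed path avoiding $u$. A vertex $u$ is ambiguous if there exist $x\in N^{in}(u)\cap A(u)\cap B(u)$ and $y\in N^{out}(u)\cap A(u)\cap B(u)$. -}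

module Defs where

open import Data.Nat using (ℕ)
open import Data.Fin using (Fin; _≟_)
open import Data.Bool using (Bool; true; false; _∨_; _∧_; if_then_else_)
open import Data.Maybe using (Maybe; just; nothing)
open import Data.List using (List)
open import Data.Bool.ListAction using (any)
open import Data.Vec using (Vec; tabulate)
open import Data.Product using (Σ; _×_)
open import Data.Empty using (⊥)
open import Relation.Nullary.Decidable using (⌊_⌋)
open import Relation.Binary.PropositionalEquality using (_≡_)

Adj : ℕ → Set
Adj n = Fin n → Fin n → Bool

data Walk {n : ℕ} (adj : Adj n) : Fin n → Fin n → Set where
  end  : (x : Fin n) → Walk adj x x
  step : {x y z : Fin n} → adj x y ≡ true → Walk adj y z → Walk adj x z

module _ {n : ℕ} {adj : Adj n} where

  visits : {x y : Fin n} → Walk adj x y → Fin n → Bool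
  visits (end x) v = ⌊ x ≟ v ⌋
  visits (step {x} _ w) v = ⌊ x ≟ v ⌋ ∨ visits w v

  traverses : {x y : Fin n} → Walk adj x y → Fin n → Fin n → Bool
  traverses (end x) a b = false
  traverses (step {x} {y} _ w) a b = (⌊ x ≟ a ⌋ ∧ ⌊ y ≟ b ⌋) ∨ traverses w a b

record IsCFG {n : ℕ} (adj : Adj n) (s t : Fin n) : Set where
  field
    s≢t        : s ≡ t → ⊥
    s-in-deg0  : (x : Fin n) → adj x s ≡ false
    t-out-deg0 : (y : Fin n) → adj t y ≡ false
    from-s     : (v : Fin n) → Walk adj s v
    to-t       : (v : Fin n) → Walk adj v t

Trace : {n : ℕ} → Adj n → Fin n → Fin n → Set
Trace adj s t = List (Walk adj s t)

vcov : {n : ℕ} {adj : Adj n} {s t : Fin n} → Trace adj s t → Fin n → Bool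
vcov T v = any (λ w → visits w v) T

-- edge coverage profile (evaluated at pairs (a,b); only meaningful on edges)
ecov : {n : ℕ} {adj : Adj n} {s t : Fin n} → Trace adj s t → Fin n → Fin n → Bool
ecov T a b = any (λ w → traverses w a b) T

Restricted : ℕ → Set
Restricted n = Vec (Vec (Maybe Bool) n) n

restrict : {n : ℕ} → (F : Adj n) → (Fin n → Fin n → Bool) → Restricted n
restrict F prof = tabulate λ a → tabulate λ b → if F a b then just (prof a b) else nothing

SubEdges : {n : ℕ} → Adj n → Adj n → Set
SubEdges {n} F adj = (a b : Fin n) → F a b ≡ true → adj a b ≡ true

Valid : (n : ℕ) (adj : Adj n) (s t : Fin n) → Adj n → (Restricted n → Fin n → Bool) → Set
Valid n adj s t F Ψ = (T : Trace adj s t) (v : Fin n) → Ψ (restrict F (ecov T)) v ≡ vcov T v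

InA : {n : ℕ} (adj : Adj n) (s : Fin n) → Fin n → Fin n → Set
InA adj s u v = Σ (Walk adj s v) (λ w → visits w u ≡ false)

InB : {n : ℕ} (adj : Adj n) (t : Fin n) → Fin n → Fin n → Set
InB adj t u v = Σ (Walk adj v t) (λ w → visits w u ≡ false)

Ambiguous : {n : ℕ} (adj : Adj n) (s t : Fin n) → Fin n → Set
Ambiguous adj s t u =
  Σ (Fin _) (λ x → adj x u ≡ true × InA adj s u x × InB adj t u x) ×
  Σ (Fin _) (λ y → adj u y ≡ true × InA adj s u y × InB adj t u y)

-- Suppose a valid scheme leaves unmonitored some edge (x,u) and some edge (u,y) with x ∈ X and
-- y ∈ Y. The trace consisting of s→x→t and s→y→t, both avoiding u, misses u; adding the walk
-- s→x→u→y→t makes it cover u, yet every monitored edge of the new walk already lies on one of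
-- the two old walks, so the restricted edge profiles agree and Ψ cannot tell the traces apart.
-- To turn this into the stated disjunction one decides whether such an x exists; this needs
-- decidability of reachability avoiding a vertex, proved by induction on the number of vertices
-- by deleting that vertex.
module Submission where

open import Defs
open import Data.Nat using (ℕ; suc)
open import Data.Fin using (Fin; _≟_; punchIn; punchOut)
open import Data.Fin.Properties using (any?; punchOut-cong; punchIn-punchOut; punchInᵢ≢i)
open import Data.Bool using (Bool; true; false; _∨_; _∧_; if_then_else_)
open import Data.Bool.Properties using (∨-assoc; ∨-zeroʳ; ∨-conicalʳ; ¬-not)
import Data.Bool.Properties as Bool
open import Data.Maybe using (just; nothing)
open import Data.Empty using (⊥)
open import Data.Sum using (_⊎_; inj₁; inj₂)
open import Data.Product using (Σ; _×_; _,_; ∃)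
open import Data.List using ([]; _∷_)
open import Data.Vec.Properties using (tabulate-cong)
open import Function using (_∘_)
open import Relation.Nullary using (Dec; yes; no; ¬_; contradiction)
open import Relation.Nullary.Decidable using (⌊_⌋; _×-dec_; map′; dec-true; dec-false; isYes≗does)
open import Relation.Binary.PropositionalEquality

⌊⌋-true : {A : Set} (a? : Dec A) → A → ⌊ a? ⌋ ≡ true
⌊⌋-true a? a = trans (isYes≗does a?) (dec-true a? a)

⌊⌋-false : {A : Set} (a? : Dec A) → ¬ A → ⌊ a? ⌋ ≡ false
⌊⌋-false a? ¬a = trans (isYes≗does a?) (dec-false a? ¬a)

∨-≡true⁻ : ∀ x {y} → x ∨ y ≡ true → x ≡ true ⊎ y ≡ true
∨-≡true⁻ true  _ = inj₁ refl
∨-≡true⁻ false p = inj₂ p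

∨-≡trueˡ : ∀ {x} y → x ≡ true → x ∨ y ≡ true
∨-≡trueˡ _ refl = refl

∨-≡trueʳ : ∀ x {y} → y ≡ true → x ∨ y ≡ true
∨-≡trueʳ x refl = ∨-zeroʳ x

∨-absorbʳ : ∀ x y → (x ≡ true → y ≡ true) → x ∨ y ≡ y
∨-absorbʳ true  y x⇒y = sym (x⇒y refl)
∨-absorbʳ false y x⇒y = refl

≟-pair-false : ∀ {n} {p q a b : Fin n} → ¬ (p ≡ a × q ≡ b) → ⌊ p ≟ a ⌋ ∧ ⌊ q ≟ b ⌋ ≡ false
≟-pair-false {p = p} {q} {a} {b} p,q≢a,b with p ≟ a | q ≟ b
... | yes p≡a | yes q≡b = contradiction (p≡a , q≡b) p,q≢a,b
... | yes _   | no _    = refl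
... | no _    | _       = refl

Avoiding : ∀ {n} → Adj n → Fin n → Fin n → Fin n → Set
Avoiding adj a x y = Σ (Walk adj x y) (λ w → visits w a ≡ false)

module _ {n : ℕ} {adj : Adj n} where

  _++_ : {x y z : Fin n} → Walk adj x y → Walk adj y z → Walk adj x z
  end _    ++ w′ = w′
  step e w ++ w′ = step e (w ++ w′)

  visits-start : {x y : Fin n} (w : Walk adj x y) → visits w x ≡ true
  visits-start (end x)        = ⌊⌋-true (x ≟ x) refl
  visits-start (step {x} _ w) = ∨-≡trueˡ (visits w x) (⌊⌋-true (x ≟ x) refl)

  visits-end : {x y : Fin n} (w : Walk adj x y) → visits w y ≡ true
  visits-end (end x)        = ⌊⌋-true (x ≟ x) refl
  visits-end (step {x} _ w) = ∨-≡trueʳ ⌊ x ≟ _ ⌋ (visits-end w)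

  avoids-start : {a x y : Fin n} (w : Walk adj x y) → visits w a ≡ false → a ≢ x
  avoids-start w avoids refl with () ← trans (sym (visits-start w)) avoids

  avoids-end : {a x y : Fin n} (w : Walk adj x y) → visits w a ≡ false → a ≢ y
  avoids-end w avoids refl with () ← trans (sym (visits-end w)) avoids

  visits-++ : {x y z : Fin n} (w : Walk adj x y) (w′ : Walk adj y z) (v : Fin n) →
              visits (w ++ w′) v ≡ visits w v ∨ visits w′ v
  visits-++ (end x) w′ v with x ≟ v
  ... | yes refl = visits-start w′
  ... | no _     = refl
  visits-++ (step {x} _ w) w′ v =
    trans (cong (⌊ x ≟ v ⌋ ∨_) (visits-++ w w′ v)) (sym (∨-assoc ⌊ x ≟ v ⌋ (visits w v) (visits w′ v)))

  traverses-++ : {x y z : Fin n} (w : Walk adj x y) (w′ : Walk adj y z) (a b : Fin n) →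
                 traverses (w ++ w′) a b ≡ traverses w a b ∨ traverses w′ a b
  traverses-++ (end x) w′ a b = refl
  traverses-++ (step {x} {y} _ w) w′ a b =
    trans (cong (⌊ x ≟ a ⌋ ∧ ⌊ y ≟ b ⌋ ∨_) (traverses-++ w w′ a b))
          (sym (∨-assoc (⌊ x ≟ a ⌋ ∧ ⌊ y ≟ b ⌋) (traverses w a b) (traverses w′ a b)))

  last-exit : (a : Fin n) {x y : Fin n} (w : Walk adj x y) → a ≢ y →
              visits w a ≡ false ⊎ ∃ λ c → adj a c ≡ true × Avoiding adj a c y
  last-exit a (end x) a≢x = inj₁ (⌊⌋-false (x ≟ a) (a≢x ∘ sym))
  last-exit a (step {x} {c} e w) a≢y with last-exit a w a≢y
  ... | inj₂ exit = inj₂ exit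
  ... | inj₁ w-avoids with x ≟ a
  ...   | yes refl = inj₂ (c , e , w , w-avoids)
  ...   | no _     = inj₁ w-avoids

  leave-start : {x y : Fin n} → Walk adj x y → x ≢ y → ∃ λ c → adj x c ≡ true × Avoiding adj x c y
  leave-start {x} w x≢y with last-exit x w x≢y
  ... | inj₂ exit   = exit
  ... | inj₁ avoids = contradiction refl (avoids-start w avoids)

removeVertex : ∀ {m} → Adj (suc m) → Fin (suc m) → Adj m
removeVertex adj a i j = adj (punchIn a i) (punchIn a j)

module _ {m : ℕ} {adj : Adj (suc m)} {a : Fin (suc m)} where

  liftWalk : {i j : Fin m} → Walk (removeVertex adj a) i j → Avoiding adj a (punchIn a i) (punchIn a j)
  liftWalk (end i) = end (punchIn a i) , ⌊⌋-false (punchIn a i ≟ a) (punchInᵢ≢i a i)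
  liftWalk (step {i} e w) with liftWalk w
  ... | w′ , avoids = step e w′ , cong₂ _∨_ (⌊⌋-false (punchIn a i ≟ a) (punchInᵢ≢i a i)) avoids

  lowerWalk : {x y : Fin (suc m)} (w : Walk adj x y) → visits w a ≡ false →
              (a≢x : a ≢ x) (a≢y : a ≢ y) → Walk (removeVertex adj a) (punchOut a≢x) (punchOut a≢y)
  lowerWalk (end x) _ a≢x a≢y = subst (Walk _ (punchOut a≢x)) (punchOut-cong a refl) (end (punchOut a≢x))
  lowerWalk (step {x} {c} e w) avoids a≢x a≢y =
    step e′ (lowerWalk w w-avoids a≢c a≢y)
    where
    w-avoids : visits w a ≡ false
    w-avoids = ∨-conicalʳ ⌊ x ≟ a ⌋ (visits w a) avoids
    a≢c : a ≢ c
    a≢c = avoids-start w w-avoids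
    e′ : adj (punchIn a (punchOut a≢x)) (punchIn a (punchOut a≢c)) ≡ true
    e′ = subst₂ (λ p q → adj p q ≡ true) (sym (punchIn-punchOut a≢x)) (sym (punchIn-punchOut a≢c)) e

mutual
  walk? : ∀ {n} (adj : Adj n) (x y : Fin n) → Dec (Walk adj x y)
  walk? {0} adj () y
  walk? {suc _} adj x y with x ≟ y
  ... | yes refl = yes (end x)
  ... | no x≢y   = map′ (λ (_ , e , w , _) → step e w) (λ w → leave-start w x≢y)
                        (any? λ c → (adj x c Bool.≟ true) ×-dec avoiding? adj x c y)

  -- A walk avoiding a is a walk in the graph with a deleted, which has one vertex fewer.
  avoiding? : ∀ {m} (adj : Adj (suc m)) (a x y : Fin (suc m)) → Dec (Avoiding adj a x y)
  avoiding? adj a x y with a ≟ x | a ≟ y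
  ... | yes refl | _        = no λ (w , avoids) → avoids-start w avoids refl
  ... | no _     | yes refl = no λ (w , avoids) → avoids-end w avoids refl
  ... | no a≢x   | no a≢y   =
    map′ (subst₂ (Avoiding adj a) (punchIn-punchOut a≢x) (punchIn-punchOut a≢y) ∘ liftWalk)
         (λ (w , avoids) → lowerWalk w avoids a≢x a≢y)
         (walk? (removeVertex adj a) (punchOut a≢x) (punchOut a≢y))

module _ {n : ℕ} {adj : Adj n} {s t : Fin n} where

  restrict-ecov-∷ : (F : Adj n) (w : Walk adj s t) (T : Trace adj s t) →
                    (∀ a b → F a b ≡ true → traverses w a b ≡ true → ecov T a b ≡ true) →
                    restrict F (ecov (w ∷ T)) ≡ restrict F (ecov T)
  restrict-ecov-∷ F w T covered = tabulate-cong λ a → tabulate-cong λ b → entry a b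
    where
    entry : ∀ a b → (if F a b then just (ecov (w ∷ T) a b) else nothing)
                  ≡ (if F a b then just (ecov T a b) else nothing)
    entry a b with F a b in monitored
    ... | false = refl
    ... | true  = cong just (∨-absorbʳ (traverses w a b) (ecov T a b) (covered a b monitored))

  Valid-vcov-cong : {F : Adj n} {Ψ : Restricted n → Fin n → Bool} → Valid n adj s t F Ψ →
                    (T T′ : Trace adj s t) → restrict F (ecov T) ≡ restrict F (ecov T′) →
                    ∀ v → vcov T v ≡ vcov T′ v
  Valid-vcov-cong {Ψ = Ψ} valid T T′ same v =
    trans (sym (valid T v)) (trans (cong (λ r → Ψ r v) same) (valid T′ v))

  unmonitored-detour-invalid :
    {u x y : Fin n} {F : Adj n} {Ψ : Restricted n → Fin n → Bool} → Valid n adj s t F Ψ →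
    adj x u ≡ true → adj u y ≡ true →
    InA adj s u x → InB adj t u x → InA adj s u y → InB adj t u y →
    F x u ≡ false → F u y ≡ false → ⊥
  unmonitored-detour-invalid {u} {x} {y} {F} {Ψ} valid x→u u→y (s→x , s→x-avoids) (x→t , x→t-avoids)
                             (s→y , s→y-avoids) (y→t , y→t-avoids) x→u-unmonitored u→y-unmonitored
    = contradiction (trans (sym detour-covers-u) (trans same-vcov bypass-misses-u)) λ ()
    where
    bypass : Trace adj s t
    bypass = (s→x ++ x→t) ∷ (s→y ++ y→t) ∷ []

    detour : Walk adj s t
    detour = s→x ++ step x→u (step u→y y→t)

    detour-edge : ∀ a b → F a b ≡ true → traverses detour a b ≡ true →
                  traverses s→x a b ≡ true ⊎ traverses y→t a b ≡ true
    detour-edge a b monitored traversed = ∨-≡true⁻ (traverses s→x a b) (begin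
      traverses s→x a b ∨ traverses y→t a b
        ≡⟨ cong₂ (λ p q → traverses s→x a b ∨ (p ∨ (q ∨ traverses y→t a b))) x→u-mismatch u→y-mismatch ⟨
      traverses s→x a b ∨ (⌊ x ≟ a ⌋ ∧ ⌊ u ≟ b ⌋ ∨ (⌊ u ≟ a ⌋ ∧ ⌊ y ≟ b ⌋ ∨ traverses y→t a b))
        ≡⟨ traverses-++ s→x (step x→u (step u→y y→t)) a b ⟨
      traverses detour a b
        ≡⟨ traversed ⟩
      true ∎)
      where
      open ≡-Reasoning
      x→u-mismatch : ⌊ x ≟ a ⌋ ∧ ⌊ u ≟ b ⌋ ≡ false
      x→u-mismatch = ≟-pair-false {p = x} {u} {a} {b}
        λ { (refl , refl) → contradiction (trans (sym monitored) x→u-unmonitored) λ () }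
      u→y-mismatch : ⌊ u ≟ a ⌋ ∧ ⌊ y ≟ b ⌋ ≡ false
      u→y-mismatch = ≟-pair-false {p = u} {y} {a} {b}
        λ { (refl , refl) → contradiction (trans (sym monitored) u→y-unmonitored) λ () }

    covered : ∀ a b → F a b ≡ true → traverses detour a b ≡ true → ecov bypass a b ≡ true
    covered a b monitored traversed with detour-edge a b monitored traversed
    ... | inj₁ p = ∨-≡trueˡ (ecov ((s→y ++ y→t) ∷ []) a b)
                     (trans (traverses-++ s→x x→t a b) (∨-≡trueˡ (traverses x→t a b) p))
    ... | inj₂ q = ∨-≡trueʳ (traverses (s→x ++ x→t) a b) (∨-≡trueˡ false
                     (trans (traverses-++ s→y y→t a b) (∨-≡trueʳ (traverses s→y a b) q)))

    same-profile : restrict F (ecov (detour ∷ bypass)) ≡ restrict F (ecov bypass)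
    same-profile = restrict-ecov-∷ F detour bypass covered

    same-vcov : vcov (detour ∷ bypass) u ≡ vcov bypass u
    same-vcov = Valid-vcov-cong {F = F} {Ψ} valid (detour ∷ bypass) bypass same-profile u

    detour-covers-u : vcov (detour ∷ bypass) u ≡ true
    detour-covers-u = ∨-≡trueˡ (vcov bypass u) (trans (visits-++ s→x (step x→u (step u→y y→t)) u)
      (∨-≡trueʳ (visits s→x u) (∨-≡trueʳ ⌊ x ≟ u ⌋ (∨-≡trueˡ (visits y→t u) (⌊⌋-true (u ≟ u) refl)))))

    bypass-misses-u : vcov bypass u ≡ false
    bypass-misses-u
      rewrite visits-++ s→x x→t u | s→x-avoids | x→t-avoids
            | visits-++ s→y y→t u | s→y-avoids | y→t-avoids = refl

lemma11 : {n : ℕ} (adj : Adj n) (s t : Fin n) → IsCFG adj s t →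
          (u : Fin n) → Ambiguous adj s t u →
          (F : Adj n) (Ψ : Restricted n → Fin n → Bool) →
          SubEdges F adj → Valid n adj s t F Ψ →
          ((x : Fin n) → adj x u ≡ true → InA adj s u x → InB adj t u x → F x u ≡ true)
          ⊎ ((y : Fin n) → adj u y ≡ true → InA adj s u y → InB adj t u y → F u y ≡ true)
lemma11 {0} _ () _ _ _ _ _ _ _ _
lemma11 {suc _} adj s t _ u _ F Ψ _ valid with any? unmonitored-entry?
  where
  unmonitored-entry? : ∀ x → Dec (adj x u ≡ true × InA adj s u x × InB adj t u x × F x u ≡ false)
  unmonitored-entry? x = (adj x u Bool.≟ true) ×-dec avoiding? adj u s x
                         ×-dec avoiding? adj u x t ×-dec (F x u Bool.≟ false)
... | no none = inj₁ λ x x→u sx xt → ¬-not λ unmonitored → none (x , x→u , sx , xt , unmonitored)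
... | yes (x , x→u , sx , xt , x→u-unmonitored) =
  inj₂ λ y u→y sy yt →
    ¬-not (unmonitored-detour-invalid {F = F} {Ψ} valid x→u u→y sx xt sy yt x→u-unmonitored)
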